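{- Let $k\ge2$ and $n\in\mathbb{N}$. If $A=I(k,n,w)$ for some $w\in S_n$, then there is a sequence of legal firings starting from the chips $0,1,\dots,k^{n+1}-1$ at the root of the $k$-ary tree that ends in a stable configuration whose sequence of chips on layer $n+2$, read left to right, has exactly $kA$ inversions.
   Context: The infinite rooted directed $k$-ary tree has a root on layer $1$; every vertex has $k$ children, ordered left to right, on the next layer. A vertex with at least $k$ chips may (legally) fire by choosing $k$ of its labeled chips and sending the $j$th smallest to its $j$th leftmost child; a configuration is stable if no vertex has at least $k$ chips. Starting with $k^N$ chips at the root, every stable configuration reached has exactly one chip on each vertex of layer $N+1$ and no chips elsewhere, and it is recorded as the sequence of chips on layer $N+1$ read left to right. Chips $0,\dots,k^n-1$ are written in $n$-digit $k$-ary expansion. For $w\in S_n$, the strategy $F_w$ fires, for each $i\in[n]$, each vertex $v$ on layer $i$ so that all chips on $v$ whose $w_i$th most significant digit equals $j$ go to the $(j+1)$th leftmost child of $v$. $I(k,n,w)$ is the number of inversions of the resulting stable configuration (pairs of positions $a<b$ with entry at $a$ larger than entry at $b$). -}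

module Defs where

open import Data.Nat using (ℕ; zero; suc; _+_; _*_; _∸_; _^_; _<_; NonZero)
open import Data.Nat.DivMod using (_/_; _mod_)
open import Data.Fin as Fin using (Fin; toℕ)
open import Data.Fin.Permutation using (Permutation′; _⟨$⟩ʳ_)
open import Data.List using (List; []; _∷ʳ_; length; filter; map; cartesianProduct; allFin)
open import Data.List.Properties using (≡-dec)
open import Data.List.Relation.Binary.Lex.Strict using (Lex-<; <-decidable)
open import Data.Product using (Σ; ∃; _×_; _,_; proj₁; proj₂)
open import Relation.Binary.PropositionalEquality using (_≡_; _≢_)
open import Relation.Nullary using (Dec; yes; no)
open import Relation.Nullary.Decidable using (_×-dec_)
open import Data.Nat.Properties using (_≟_; _<?_; m^n≢0)

-- Vertices of the infinite rooted k-ary tree: paths from the root,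
-- written root-first. The root is [], the (j+1)-th leftmost child of v is v ∷ʳ j.
-- A vertex v lies on layer (length v + 1).
Vertex : ℕ → Set
Vertex k = List (Fin k)

_◁_ : ∀ {k} → Vertex k → Vertex k → Set
_◁_ = Lex-< _≡_ Fin._<_

_◁?_ : ∀ {k} (u v : Vertex k) → Dec (u ◁ v)
_◁?_ = <-decidable Fin._≟_ Fin._<?_

_≟ᵥ_ : ∀ {k} (u v : Vertex k) → Dec (u ≡ v)
_≟ᵥ_ = ≡-dec Fin._≟_

Config : ℕ → ℕ → Set
Config k M = Fin M → Vertex k

initial : ∀ {k M} → Config k M
initial _ = []

chipsAt : ∀ {k M} → Config k M → Vertex k → ℕ
chipsAt {M = M} c v = length (filter (λ i → c i ≟ᵥ v) (allFin M))

Fire : ∀ {k M} → Config k M → Config k M → Set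
Fire {k} {M} c c' =
  Σ (Vertex k) λ v → Σ (Fin k → Fin M) λ f →
    (∀ i j → i Fin.< j → toℕ (f i) < toℕ (f j)) ×
    (∀ j → c (f j) ≡ v) ×
    (∀ j → c' (f j) ≡ v ∷ʳ j) ×
    (∀ x → (∀ j → f j ≢ x) → c' x ≡ c x)

Stable : ∀ {k M} → Config k M → Set
Stable {k} c = ∀ v → chipsAt c v < k

-- Inversions of the sequence of chips on layer (ℓ+1) (vertices of path length ℓ)
-- read left to right: pairs of chips a < b on that layer with b to the left of a.
inversions : ∀ {k M} → Config k M → ℕ → ℕ
inversions {k} {M} c ℓ =
  length (filter (λ p → (toℕ (proj₁ p) <? toℕ (proj₂ p))
                   ×-dec (length (c (proj₁ p)) ≟ ℓ)
                   ×-dec (length (c (proj₂ p)) ≟ ℓ)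
                   ×-dec (c (proj₂ p) ◁? c (proj₁ p)))
                 (cartesianProduct (allFin M) (allFin M)))

-- The m-th most significant digit (m = 1,…,n) of x in n-digit base-k expansion.
digit : ∀ k .{{_ : NonZero k}} (n m x : ℕ) → Fin k
digit k n m x = ((_/_ x (k ^ (n ∸ m))) {{m^n≢0 k (n ∸ m)}}) mod k

-- Final configuration of the strategy F_w on chips 0,…,k^n-1: at layer i
-- (i = 1,…,n) chip x goes to the child indexed by its w_i-th most
-- significant digit, so it ends at the path (d_{w_1}(x), …, d_{w_n}(x)).
Fw-config : ∀ k .{{_ : NonZero k}} (n : ℕ) → Permutation′ n → Config k (k ^ n)
Fw-config k n w x = map (λ i → digit k n (suc (toℕ (w ⟨$⟩ʳ i))) (toℕ x)) (allFin n)

I : ∀ k .{{_ : NonZero k}} (n : ℕ) → Permutation′ n → ℕ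
I k n w = inversions (Fw-config k n w) n

{-# OPTIONS --safe #-}
module Submission where

open import Defs
open import Data.Bool.Base using (true; false; if_then_else_)
open import Data.Empty using (⊥-elim)
open import Data.Fin as Fin using (Fin; toℕ; fromℕ<)
open import Data.Fin.Permutation using (Permutation′; _⟨$⟩ʳ_; _⟨$⟩ˡ_; inverseʳ; lift₀)
open import Data.Fin.Properties using (toℕ-fromℕ<; toℕ-injective; toℕ<n)
open import Data.List as List
  using (List; []; _∷_; _++_; _∷ʳ_; map; filter; length; cartesianProduct; allFin; tabulate)
open import Data.List.Membership.Propositional.Properties using (∈-map⁺; ∈-allFin)
open import Data.List.Properties
  using (∷-injective; map-cong; map-cong-local; map-++; map-∘; map-tabulate; ++-assoc; ++-identityʳ)
open import Data.List.Relation.Binary.Lex.Strict using (this; next)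
open import Data.List.Relation.Unary.All as All using (All; []; _∷_)
open import Data.List.Relation.Unary.All.Properties using (++⁻ʳ; all-filter)
open import Data.List.Relation.Unary.AllPairs using (_∷_)
open import Data.List.Relation.Unary.Any using (here; there)
open import Data.List.Relation.Unary.Unique.Propositional using (Unique)
import Data.List.Relation.Unary.Unique.Propositional.Properties as Unique
open import Data.Nat
  using (ℕ; zero; suc; _+_; _*_; _∸_; _^_; _<_; _≤_; z≤n; s≤s; NonZero; >-nonZero⁻¹; _/_; _%_)
open import Data.Nat.DivMod
open import Data.Nat.Divisibility using (n∣m*n; m∣m*n; ∣n⇒∣m*n)
open import Data.Nat.ListAction using (sum)
open import Data.Nat.ListAction.Properties using (sum-++)
open import Data.Nat.Properties
open import Data.Product using (Σ; ∃; _×_; _,_; proj₁; proj₂)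
open import Data.Sum using (_⊎_; inj₁; inj₂)
open import Data.Vec as Vec using (Vec; []; _∷_; _[_]≔_)
open import Data.Vec.Properties
  using (≡-dec; tabulate-cong; lookup∘tabulate; lookup∘update; lookup∘update′; []≔-idempotent; []≔-lookup)
open import Function.Base using (_∘_)
open import Function.Bundles using (_⇔_; mk⇔; Injection)
open import Function.Properties.Inverse using (Inverse⇒Injection)
open import Relation.Binary.Construct.Closure.ReflexiveTransitive using (Star; ε; _◅_; _◅◅_)
open import Relation.Binary.PropositionalEquality
open import Relation.Nullary using (Dec; yes; no; does)
open import Relation.Nullary.Decidable using (_×-dec_; does-⇔; dec-true; dec-false)
open import Relation.Unary using (Pred; Decidable)

-- The witness is the final configuration of F_{1⊕w} (the permutation lift₀ w fixing the first
-- digit), which sorts the chips by their leading digit before acting as F_w on each of the k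
-- blocks of k^n consecutive chips. Since the leading digit is at once the most significant digit
-- and the first turn of the path, chips of different blocks are never inverted, while inside a
-- block the inversions are those of F_w; hence k · I(k,n,w) inversions.
--
-- Any digit-reading configuration (chip x at the path of its digits at distinct positions
-- p₁,…,pₜ) is reachable: to append pₜ, fire for every class of chips differing only in digit pₜ
-- the common vertex of its k members. Distinct chips have distinct digits, hence distinct
-- positions under F_π, so the final configuration is stable.

⟦_⟧ : ∀ {a} {A : Set a} → Dec A → ℕ
⟦ a? ⟧ = if does a? then 1 else 0

⟦⟧-× : ∀ {a b} {A : Set a} {B : Set b} (a? : Dec A) (b? : Dec B) → ⟦ a? ×-dec b? ⟧ ≡ ⟦ a? ⟧ * ⟦ b? ⟧
⟦⟧-× (yes _) (yes _) = refl
⟦⟧-× (yes _) (no _)  = refl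
⟦⟧-× (no _)  _       = refl

⟦⟧-⇔ : ∀ {a b} {A : Set a} {B : Set b} → A ⇔ B → (a? : Dec A) (b? : Dec B) → ⟦ a? ⟧ ≡ ⟦ b? ⟧
⟦⟧-⇔ A⇔B a? b? = cong (if_then 1 else 0) (does-⇔ A⇔B a? b?)

length-filter≡sum : ∀ {a p} {A : Set a} {P : Pred A p} (P? : Decidable P) (xs : List A) →
                    length (filter P? xs) ≡ sum (map (⟦_⟧ ∘ P?) xs)
length-filter≡sum P? []       = refl
length-filter≡sum P? (x ∷ xs) with does (P? x)
... | true  = cong suc (length-filter≡sum P? xs)
... | false = length-filter≡sum P? xs

sum-map-cartesianProduct : ∀ {a b} {A : Set a} {B : Set b} (f : A × B → ℕ) (xs : List A) (ys : List B) →
  sum (map f (cartesianProduct xs ys)) ≡ sum (map (λ x → sum (map (λ y → f (x , y)) ys)) xs)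
sum-map-cartesianProduct f []       ys = refl
sum-map-cartesianProduct f (x ∷ xs) ys = begin
  sum (map f (map (x ,_) ys ++ cartesianProduct xs ys))
    ≡⟨ cong sum (map-++ f (map (x ,_) ys) _) ⟩
  sum (map f (map (x ,_) ys) ++ map f (cartesianProduct xs ys))
    ≡⟨ sum-++ (map f (map (x ,_) ys)) _ ⟩
  sum (map f (map (x ,_) ys)) + sum (map f (cartesianProduct xs ys))
    ≡⟨ cong₂ _+_ (cong sum (sym (map-∘ ys))) (sum-map-cartesianProduct f xs ys) ⟩
  sum (map (λ y → f (x , y)) ys) + sum (map (λ x → sum (map (λ y → f (x , y)) ys)) xs) ∎
  where open ≡-Reasoning

∑ : ℕ → (ℕ → ℕ) → ℕ
∑ zero    f = 0
∑ (suc n) f = f 0 + ∑ n (f ∘ suc)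

infix 5 ∑
syntax ∑ n (λ i → e) = ∑[ i < n ] e

sum-map-allFin : ∀ n (f : ℕ → ℕ) → sum (map (f ∘ toℕ) (allFin n)) ≡ ∑ n f
sum-map-allFin n f = trans (cong sum (map-tabulate {n = n} (λ i → i) (f ∘ toℕ))) (sum-tabulate n f)
  where
  sum-tabulate : ∀ n (f : ℕ → ℕ) → sum (tabulate {n = n} (f ∘ toℕ)) ≡ ∑ n f
  sum-tabulate zero    f = refl
  sum-tabulate (suc n) f = cong (f 0 +_) (sum-tabulate n (f ∘ suc))

∑-cong : ∀ n {f g : ℕ → ℕ} → (∀ {i} → i < n → f i ≡ g i) → ∑ n f ≡ ∑ n g
∑-cong zero    f≡g = refl
∑-cong (suc n) f≡g = cong₂ _+_ (f≡g (s≤s z≤n)) (∑-cong n (f≡g ∘ s≤s))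

∑-+ : ∀ m n (f : ℕ → ℕ) → ∑ (m + n) f ≡ ∑ m f + (∑[ i < n ] f (m + i))
∑-+ zero    n f = refl
∑-+ (suc m) n f = trans (cong (f 0 +_) (∑-+ m n (f ∘ suc))) (sym (+-assoc (f 0) _ _))

∑-* : ∀ m n (f : ℕ → ℕ) → ∑ (m * n) f ≡ ∑[ r < m ] ∑[ q < n ] f (r * n + q)
∑-* zero    n f = refl
∑-* (suc m) n f = begin
  ∑ (n + m * n) f                                       ≡⟨ ∑-+ n (m * n) f ⟩
  ∑ n f + (∑[ i < m * n ] f (n + i))                    ≡⟨ cong (∑ n f +_) (∑-* m n (f ∘ (n +_))) ⟩
  ∑ n f + (∑[ r < m ] ∑[ q < n ] f (n + (r * n + q)))   ≡⟨ cong (∑ n f +_) (∑-cong m λ {r} _ →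
                                                             ∑-cong n λ {q} _ → cong f (sym (+-assoc n (r * n) q))) ⟩
  ∑ n f + (∑[ r < m ] ∑[ q < n ] f (suc r * n + q))     ∎
  where open ≡-Reasoning

∑-distribˡ : ∀ n c (f : ℕ → ℕ) → ∑[ i < n ] c * f i ≡ c * ∑ n f
∑-distribˡ zero    c f = sym (*-zeroʳ c)
∑-distribˡ (suc n) c f = trans (cong (c * f 0 +_) (∑-distribˡ n c (f ∘ suc))) (sym (*-distribˡ-+ c (f 0) _))

∑-const : ∀ n c → ∑[ _ < n ] c ≡ n * c
∑-const zero    c = refl
∑-const (suc n) c = cong (c +_) (∑-const n c)

∑-⟦≟⟧ : ∀ n {r} c → r < n → ∑[ s < n ] ⟦ r ≟ s ⟧ * c ≡ c
∑-⟦≟⟧ (suc n) {zero}  c _         = begin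
  1 * c + (∑[ _ < n ] 0)  ≡⟨ cong₂ _+_ (*-identityˡ c) (∑-const n 0) ⟩
  c + n * 0               ≡⟨ cong (c +_) (*-zeroʳ n) ⟩
  c + 0                   ≡⟨ +-identityʳ c ⟩
  c                       ∎
  where open ≡-Reasoning
∑-⟦≟⟧ (suc n) {suc r} c (s≤s r<n) = ∑-⟦≟⟧ n c r<n

r<r′⇒r*M+q<r′*M+q′ : ∀ {M r r′} q q′ → r < r′ → q < M → r * M + q < r′ * M + q′
r<r′⇒r*M+q<r′*M+q′ {M} {r} {r′} q q′ r<r′ q<M = begin-strict
  r * M + q      <⟨ +-monoʳ-< (r * M) q<M ⟩
  r * M + M      ≡⟨ +-comm (r * M) M ⟩
  suc r * M      ≤⟨ *-monoˡ-≤ M r<r′ ⟩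
  r′ * M         ≤⟨ m≤m+n (r′ * M) q′ ⟩
  r′ * M + q′    ∎
  where open ≤-Reasoning

module _ {k : ℕ} where

  Inverted : (ℕ → Vertex k) → ℕ → ℕ → ℕ → Set
  Inverted f ℓ a b = a < b × length (f a) ≡ ℓ × length (f b) ≡ ℓ × f b ◁ f a

  inverted? : ∀ f ℓ a b → Dec (Inverted f ℓ a b)
  inverted? f ℓ a b = (a <? b) ×-dec (length (f a) ≟ ℓ) ×-dec (length (f b) ≟ ℓ) ×-dec (f b ◁? f a)

  countInversions : ℕ → (ℕ → Vertex k) → ℕ → ℕ
  countInversions T f ℓ = ∑[ a < T ] ∑[ b < T ] ⟦ inverted? f ℓ a b ⟧

  inversions≡countInversions : ∀ T (f : ℕ → Vertex k) ℓ →
                               inversions {M = T} (f ∘ toℕ) ℓ ≡ countInversions T f ℓ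
  inversions≡countInversions T f ℓ = begin
    inversions {M = T} (f ∘ toℕ) ℓ
      ≡⟨ length-filter≡sum _ (cartesianProduct (allFin T) (allFin T)) ⟩
    sum (map (λ (x , y) → ⟦ inverted? f ℓ (toℕ x) (toℕ y) ⟧) (cartesianProduct (allFin T) (allFin T)))
      ≡⟨ sum-map-cartesianProduct _ (allFin T) (allFin T) ⟩
    sum (map (λ x → sum (map (λ y → ⟦ inverted? f ℓ (toℕ x) (toℕ y) ⟧) (allFin T))) (allFin T))
      ≡⟨ sum-map-allFin T (λ a → sum (map (λ y → ⟦ inverted? f ℓ a (toℕ y) ⟧) (allFin T))) ⟩
    ∑[ a < T ] sum (map (λ y → ⟦ inverted? f ℓ a (toℕ y) ⟧) (allFin T))
      ≡⟨ ∑-cong T (λ {a} _ → sum-map-allFin T (λ b → ⟦ inverted? f ℓ a b ⟧)) ⟩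
    countInversions T f ℓ ∎
    where open ≡-Reasoning

  module _ (M : ℕ) (f g : ℕ → Vertex k)
           (f-block : ∀ {r q} (r<k : r < k) → q < M → f (r * M + q) ≡ fromℕ< r<k ∷ g q) where

    inverted-block⇔ : ∀ ℓ {r r′ q q′} → r < k → r′ < k → q < M → q′ < M →
                      Inverted f (suc ℓ) (r * M + q) (r′ * M + q′) ⇔ (r ≡ r′ × Inverted g ℓ q q′)
    inverted-block⇔ ℓ {r} {r′} {q} {q′} r<k r′<k q<M q′<M = mk⇔ to from
      where
      length-g : ∀ {r q} (r<k : r < k) → q < M → length (f (r * M + q)) ≡ suc ℓ → length (g q) ≡ ℓ
      length-g r<k q<M len = suc-injective (trans (cong length (sym (f-block r<k q<M))) len)

      to : Inverted f (suc ℓ) (r * M + q) (r′ * M + q′) → r ≡ r′ × Inverted g ℓ q q′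
      to (a<b , len-a , len-b , b◁a) with subst₂ _◁_ (f-block r′<k q′<M) (f-block r<k q<M) b◁a
      ... | this r′<r = ⊥-elim (<-asym a<b (r<r′⇒r*M+q<r′*M+q′ q′ q
                           (subst₂ _<_ (toℕ-fromℕ< r′<k) (toℕ-fromℕ< r<k) r′<r) q′<M))
      ... | next r′≡r q′◁q = r≡r′ , +-cancelˡ-< (r * M) q q′ (subst (λ s → r * M + q < s * M + q′) (sym r≡r′) a<b)
                            , length-g r<k q<M len-a , length-g r′<k q′<M len-b , q′◁q
        where
        r≡r′ : r ≡ r′
        r≡r′ = trans (sym (toℕ-fromℕ< r<k)) (trans (cong toℕ (sym r′≡r)) (toℕ-fromℕ< r′<k))

      from : r ≡ r′ × Inverted g ℓ q q′ → Inverted f (suc ℓ) (r * M + q) (r′ * M + q′)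
      from (refl , q<q′ , len-q , len-q′ , q′◁q) rewrite f-block r<k q<M | f-block r′<k q′<M =
        +-monoʳ-< (r * M) q<q′ , cong suc len-q , cong suc len-q′ , next refl q′◁q

    countInversions-block : ∀ ℓ → countInversions (k * M) f (suc ℓ) ≡ k * countInversions M g ℓ
    countInversions-block ℓ = begin
      ∑[ a < k * M ] ∑[ b < k * M ] ⟦ inverted? f (suc ℓ) a b ⟧
        ≡⟨ ∑-* k M _ ⟩
      ∑[ r < k ] ∑[ q < M ] ∑[ b < k * M ] ⟦ inverted? f (suc ℓ) (r * M + q) b ⟧
        ≡⟨ ∑-cong k (λ r<k → ∑-cong M (λ q<M → row r<k q<M)) ⟩
      ∑[ r < k ] ∑[ q < M ] ∑[ q′ < M ] ⟦ inverted? g ℓ q q′ ⟧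
        ≡⟨ ∑-const k _ ⟩
      k * countInversions M g ℓ ∎
      where
      open ≡-Reasoning
      row : ∀ {r q} → r < k → q < M →
            ∑[ b < k * M ] ⟦ inverted? f (suc ℓ) (r * M + q) b ⟧ ≡ ∑[ q′ < M ] ⟦ inverted? g ℓ q q′ ⟧
      row {r} {q} r<k q<M = begin
        ∑[ b < k * M ] ⟦ inverted? f (suc ℓ) (r * M + q) b ⟧
          ≡⟨ ∑-* k M _ ⟩
        ∑[ r′ < k ] ∑[ q′ < M ] ⟦ inverted? f (suc ℓ) (r * M + q) (r′ * M + q′) ⟧
          ≡⟨ ∑-cong k (λ {r′} r′<k → ∑-cong M (λ {q′} q′<M →
               trans (⟦⟧-⇔ (inverted-block⇔ ℓ r<k r′<k q<M q′<M) (inverted? f (suc ℓ) _ _) ((r ≟ r′) ×-dec inverted? g ℓ q q′))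
                     (⟦⟧-× (r ≟ r′) (inverted? g ℓ q q′)))) ⟩
        ∑[ r′ < k ] ∑[ q′ < M ] ⟦ r ≟ r′ ⟧ * ⟦ inverted? g ℓ q q′ ⟧
          ≡⟨ ∑-cong k (λ {r′} _ → ∑-distribˡ M ⟦ r ≟ r′ ⟧ _) ⟩
        ∑[ r′ < k ] ⟦ r ≟ r′ ⟧ * (∑[ q′ < M ] ⟦ inverted? g ℓ q q′ ⟧)
          ≡⟨ ∑-⟦≟⟧ k _ r<k ⟩
        ∑[ q′ < M ] ⟦ inverted? g ℓ q q′ ⟧ ∎

module _ (k : ℕ) .{{_ : NonZero k}} where

  digits : ∀ N → ℕ → Vec (Fin k) N
  digits N x = Vec.tabulate λ i → digit k N (suc (toℕ i)) x

  fromDigits : ∀ {N} → Vec (Fin k) N → ℕ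
  fromDigits             []       = 0
  fromDigits {N = suc N} (d ∷ ds) = toℕ d * k ^ N + fromDigits ds

  digit-+-multiple : ∀ N {m} r q → m < N → digit k N (suc m) (r * k ^ N + q) ≡ digit k N (suc m) q
  digit-+-multiple N {m} r q m<N = toℕ-injective (begin
    toℕ (digit k N (suc m) (r * k ^ N + q))    ≡⟨ toℕ-fromℕ< _ ⟩
    (r * k ^ N + q) / k ^ e % k                ≡⟨ cong (λ K → (r * K + q) / k ^ e % k) k^N≡ ⟩
    (r * (k ^ suc m * k ^ e) + q) / k ^ e % k  ≡⟨ cong (λ z → (z + q) / k ^ e % k) (sym (*-assoc r _ _)) ⟩
    (r * k ^ suc m * k ^ e + q) / k ^ e % k    ≡⟨ cong (_% k) (+-distrib-/-∣ˡ q {k ^ e} (n∣m*n (r * k ^ suc m))) ⟩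
    (r * k ^ suc m * k ^ e / k ^ e + q / k ^ e) % k
                                               ≡⟨ cong (λ z → (z + q / k ^ e) % k) (m*n/n≡m (r * k ^ suc m) (k ^ e)) ⟩
    (r * k ^ suc m + q / k ^ e) % k            ≡⟨ %-remove-+ˡ (q / k ^ e) (∣n⇒∣m*n r (m∣m*n (k ^ m))) ⟩
    q / k ^ e % k                              ≡⟨ toℕ-fromℕ< _ ⟨
    toℕ (digit k N (suc m) q)                  ∎)
    where
    open ≡-Reasoning
    e : ℕ
    e = N ∸ suc m
    instance
      k^e≢0 : NonZero (k ^ e)
      k^e≢0 = m^n≢0 k e
    k^N≡ : k ^ N ≡ k ^ suc m * k ^ e
    k^N≡ = trans (cong (k ^_) (sym (m+[n∸m]≡n m<N))) (^-distribˡ-+-* k (suc m) e)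

  toℕ-leadingDigit : ∀ N r {q} → q < k ^ N → toℕ (digit k (suc N) 1 (r * k ^ N + q)) ≡ r % k
  toℕ-leadingDigit N r {q} q<k^N = trans (toℕ-fromℕ< _) (cong (_% k) (begin
    (r * k ^ N + q) / k ^ N              ≡⟨ +-distrib-/-∣ˡ q {k ^ N} (n∣m*n r) ⟩
    r * k ^ N / k ^ N + q / k ^ N        ≡⟨ cong₂ _+_ (m*n/n≡m r (k ^ N)) (m<n⇒m/n≡0 q<k^N) ⟩
    r + 0                                ≡⟨ +-identityʳ r ⟩
    r                                    ∎))
    where
    open ≡-Reasoning
    instance
      k^N≢0 : NonZero (k ^ N)
      k^N≢0 = m^n≢0 k N

  digits-+-multiple : ∀ N r q → digits N (r * k ^ N + q) ≡ digits N q
  digits-+-multiple N r q = tabulate-cong λ i → digit-+-multiple N r q (toℕ<n i)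

  fromDigits< : ∀ {N} (ds : Vec (Fin k) N) → fromDigits ds < k ^ N
  fromDigits<             []       = s≤s z≤n
  fromDigits< {N = suc N} (d ∷ ds) = begin-strict
    toℕ d * k ^ N + fromDigits ds   <⟨ +-monoʳ-< (toℕ d * k ^ N) (fromDigits< ds) ⟩
    toℕ d * k ^ N + k ^ N           ≡⟨ +-comm _ (k ^ N) ⟩
    suc (toℕ d) * k ^ N             ≤⟨ *-monoˡ-≤ (k ^ N) (toℕ<n d) ⟩
    k ^ suc N                       ∎
    where open ≤-Reasoning

  digits-fromDigits : ∀ {N} (ds : Vec (Fin k) N) → digits N (fromDigits ds) ≡ ds
  digits-fromDigits             []       = refl
  digits-fromDigits {N = suc N} (d ∷ ds) = cong₂ _∷_
    (toℕ-injective (trans (toℕ-leadingDigit N (toℕ d) (fromDigits< ds)) (m<n⇒m%n≡m (toℕ<n d))))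
    (trans (digits-+-multiple N (toℕ d) (fromDigits ds)) (digits-fromDigits ds))

  fromDigits-digits : ∀ N {x} → x < k ^ N → fromDigits (digits N x) ≡ x
  fromDigits-digits zero    {zero} _         = refl
  fromDigits-digits zero    {suc x} (s≤s ())
  fromDigits-digits (suc N) {x}    x<k^N = begin
    toℕ (digit k (suc N) 1 x) * k ^ N + fromDigits (digits N x)
      ≡⟨ cong₂ (λ d ds → d * k ^ N + fromDigits ds) lead
               (trans (cong (digits N) x≡) (digits-+-multiple N (x / k ^ N) (x % k ^ N))) ⟩
    x / k ^ N * k ^ N + fromDigits (digits N (x % k ^ N))
      ≡⟨ cong (x / k ^ N * k ^ N +_) (fromDigits-digits N (m%n<n x (k ^ N))) ⟩
    x / k ^ N * k ^ N + x % k ^ N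
      ≡⟨ x≡ ⟨
    x ∎
    where
    open ≡-Reasoning
    instance
      k^N≢0 : NonZero (k ^ N)
      k^N≢0 = m^n≢0 k N
    x≡ : x ≡ x / k ^ N * k ^ N + x % k ^ N
    x≡ = trans (m≡m%n+[m/n]*n x (k ^ N)) (+-comm (x % k ^ N) _)
    lead : toℕ (digit k (suc N) 1 x) ≡ x / k ^ N
    lead = trans (toℕ-fromℕ< _) (m<n⇒m%n≡m (m<n*o⇒m/o<n {n = k} {o = k ^ N} x<k^N))

  digits-injective : ∀ N {x y} → x < k ^ N → y < k ^ N → digits N x ≡ digits N y → x ≡ y
  digits-injective N {x} {y} x<k^N y<k^N eq = begin
    x                        ≡⟨ fromDigits-digits N x<k^N ⟨
    fromDigits (digits N x)  ≡⟨ cong fromDigits eq ⟩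
    fromDigits (digits N y)  ≡⟨ fromDigits-digits N y<k^N ⟩
    y                        ∎
    where open ≡-Reasoning

  fromDigits-[]≔-< : ∀ {N} (ds : Vec (Fin k) N) p {i j : Fin k} → toℕ i < toℕ j →
                     fromDigits (ds [ p ]≔ i) < fromDigits (ds [ p ]≔ j)
  fromDigits-[]≔-< {N = suc N} (d ∷ ds) Fin.zero {i} {j} i<j =
    r<r′⇒r*M+q<r′*M+q′ (fromDigits ds) (fromDigits ds) i<j (fromDigits< ds)
  fromDigits-[]≔-< {N = suc N} (d ∷ ds) (Fin.suc p) i<j =
    +-monoʳ-< (toℕ d * k ^ N) (fromDigits-[]≔-< ds p i<j)

module _ {k M : ℕ} where

  infix 4 _⇝_

  -- Reachability up to pointwise equality: a firing lands in a configuration that is only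
  -- pointwise equal to the one we name, and there is no function extensionality.
  _⇝_ : Config k M → Config k M → Set
  a ⇝ b = ∃ λ c → Star Fire a c × c ≗ b

  Fire-respˡ : ∀ {a a′ b : Config k M} → a ≗ a′ → Fire a b → Fire a′ b
  Fire-respˡ a≗a′ (v , f , mono , src , tgt , frame) =
    v , f , mono , (λ j → trans (sym (a≗a′ (f j))) (src j)) , tgt , (λ x f≢x → trans (frame x f≢x) (a≗a′ x))

  Fire-respʳ : ∀ {a b b′ : Config k M} → b ≗ b′ → Fire a b → Fire a b′
  Fire-respʳ b≗b′ (v , f , mono , src , tgt , frame) =
    v , f , mono , src , (λ j → trans (sym (b≗b′ (f j))) (tgt j)) , (λ x f≢x → trans (sym (b≗b′ x)) (frame x f≢x))

  ≗⇒⇝ : ∀ {a b : Config k M} → a ≗ b → a ⇝ b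
  ≗⇒⇝ {a} a≗b = a , ε , a≗b

  Fire⇒⇝ : ∀ {a b : Config k M} → Fire a b → a ⇝ b
  Fire⇒⇝ {b = b} fire = b , fire ◅ ε , λ _ → refl

  Star-respˡ : ∀ {a a′ c : Config k M} → a ≗ a′ → Star Fire a c → a′ ⇝ c
  Star-respˡ a≗a′ ε            = ≗⇒⇝ (λ x → sym (a≗a′ x))
  Star-respˡ a≗a′ (fire ◅ fires) = _ , Fire-respˡ a≗a′ fire ◅ fires , λ _ → refl

  ⇝-trans : ∀ {a b c : Config k M} → a ⇝ b → b ⇝ c → a ⇝ c
  ⇝-trans (b′ , a→b′ , b′≗b) (c′ , b→c′ , c′≗c) with Star-respˡ (λ x → sym (b′≗b x)) b→c′
  ... | c″ , b′→c″ , c″≗c′ = c″ , a→b′ ◅◅ b′→c″ , λ x → trans (c″≗c′ x) (c′≗c x)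

  ⇝⇒≗⊎Star : ∀ {a b : Config k M} → a ⇝ b → a ≗ b ⊎ Star Fire a b
  ⇝⇒≗⊎Star (_ , ε            , a≗b) = inj₁ a≗b
  ⇝⇒≗⊎Star (c , fire ◅ fires , c≗b) with ⇝⇒≗⊎Star (c , fires , c≗b)
  ... | inj₁ a′≗b     = inj₂ (Fire-respʳ a′≗b fire ◅ ε)
  ... | inj₂ a′→b     = inj₂ (fire ◅ a′→b)

Unique-++-∷⇒∉ : ∀ {a} {A : Set a} (xs : List A) {y ys} → Unique (xs ++ y ∷ ys) → All (_≢ y) xs
Unique-++-∷⇒∉ []       _            = []
Unique-++-∷⇒∉ (x ∷ xs) (x∉ ∷ unique) = All.head (++⁻ʳ xs x∉) ∷ Unique-++-∷⇒∉ xs unique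

module ReadDigits (k : ℕ) .{{_ : NonZero k}} (N : ℕ) where

  open import Data.List.Membership.DecPropositional (≡-dec {n = N} (Fin._≟_ {k})) using (_∈_; _∉_; _∈?_)

  Chip : Set
  Chip = Fin (k ^ N)

  chipDigits : Chip → Vec (Fin k) N
  chipDigits x = digits k N (toℕ x)

  chipDigits-injective : ∀ {x y} → chipDigits x ≡ chipDigits y → x ≡ y
  chipDigits-injective {x} {y} eq = toℕ-injective (digits-injective k N (toℕ<n x) (toℕ<n y) eq)

  readDigits : List (Fin N) → Config k (k ^ N)
  readDigits ps x = map (Vec.lookup (chipDigits x)) ps

  module Extend (ps : List (Fin N)) (p : Fin N) (p∉ps : All (_≢ p) ps) where

    class : Chip → Vec (Fin k) N
    class x = chipDigits x [ p ]≔ fromℕ< (>-nonZero⁻¹ k)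

    sibling : Chip → Fin k → Chip
    sibling y j = fromℕ< (fromDigits< k (class y [ p ]≔ j))

    chipDigits-sibling : ∀ y j → chipDigits (sibling y j) ≡ class y [ p ]≔ j
    chipDigits-sibling y j = trans (cong (digits k N) (toℕ-fromℕ< _)) (digits-fromDigits k _)

    class-sibling : ∀ y j → class (sibling y j) ≡ class y
    class-sibling y j = begin
      chipDigits (sibling y j) [ p ]≔ _   ≡⟨ cong (_[ p ]≔ _) (chipDigits-sibling y j) ⟩
      (class y [ p ]≔ j) [ p ]≔ _         ≡⟨ []≔-idempotent (class y) p ⟩
      class y [ p ]≔ _                    ≡⟨ []≔-idempotent (chipDigits y) p ⟩
      class y                             ∎
      where open ≡-Reasoning

    class≡⇒sibling : ∀ {x y} → class x ≡ class y → x ≡ sibling y (Vec.lookup (chipDigits x) p)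
    class≡⇒sibling {x} {y} eq = chipDigits-injective (begin
      chipDigits x                  ≡⟨ []≔-lookup (chipDigits x) p ⟨
      chipDigits x [ p ]≔ d         ≡⟨ []≔-idempotent (chipDigits x) p ⟨
      class x [ p ]≔ d              ≡⟨ cong (_[ p ]≔ d) eq ⟩
      class y [ p ]≔ d              ≡⟨ chipDigits-sibling y d ⟨
      chipDigits (sibling y d)      ∎)
      where
      open ≡-Reasoning
      d : Fin k
      d = Vec.lookup (chipDigits x) p

    readDigits-class : ∀ x → readDigits ps x ≡ map (Vec.lookup (class x)) ps
    readDigits-class x = map-cong-local (All.map (λ q≢p → sym (lookup∘update′ q≢p (chipDigits x) _)) p∉ps)

    readDigits-sibling : ∀ y j → readDigits ps (sibling y j) ≡ readDigits ps y
    readDigits-sibling y j = begin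
      readDigits ps (sibling y j)                    ≡⟨ readDigits-class (sibling y j) ⟩
      map (Vec.lookup (class (sibling y j))) ps      ≡⟨ cong (λ v → map (Vec.lookup v) ps) (class-sibling y j) ⟩
      map (Vec.lookup (class y)) ps                  ≡⟨ readDigits-class y ⟨
      readDigits ps y                                ∎
      where open ≡-Reasoning

    readDigits-∷ʳ-sibling : ∀ y j → readDigits (ps ∷ʳ p) (sibling y j) ≡ readDigits ps y ∷ʳ j
    readDigits-∷ʳ-sibling y j = trans (map-++ _ ps (p ∷ []))
      (cong₂ _∷ʳ_ (readDigits-sibling y j)
                  (trans (cong (λ v → Vec.lookup v p) (chipDigits-sibling y j)) (lookup∘update p (class y) j)))

    partial : List Chip → Config k (k ^ N)
    partial ys x = if does (class x ∈? map class ys) then readDigits (ps ∷ʳ p) x else readDigits ps x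

    partial-∈ : ∀ {ys x} → class x ∈ map class ys → partial ys x ≡ readDigits (ps ∷ʳ p) x
    partial-∈ {ys} {x} x∈ = cong (if_then _ else _) (dec-true (class x ∈? map class ys) x∈)

    partial-∉ : ∀ {ys x} → class x ∉ map class ys → partial ys x ≡ readDigits ps x
    partial-∉ {ys} {x} x∉ = cong (if_then _ else _) (dec-false (class x ∈? map class ys) x∉)

    partial-cong : ∀ {ys zs x} → (class x ∈ map class ys ⇔ class x ∈ map class zs) →
                   partial ys x ≡ partial zs x
    partial-cong {ys} {zs} {x} ys⇔zs =
      cong (if_then _ else _) (does-⇔ ys⇔zs (class x ∈? map class ys) (class x ∈? map class zs))

    fire-class : ∀ y ys → class y ∉ map class ys → Fire (partial ys) (partial (y ∷ ys))
    fire-class y ys y∉ = readDigits ps y , sibling y , increasing , source , target , frame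
      where
      increasing : ∀ i j → i Fin.< j → toℕ (sibling y i) < toℕ (sibling y j)
      increasing i j i<j =
        subst₂ _<_ (sym (toℕ-fromℕ< _)) (sym (toℕ-fromℕ< _)) (fromDigits-[]≔-< k (class y) p i<j)

      source : ∀ j → partial ys (sibling y j) ≡ readDigits ps y
      source j =
        trans (partial-∉ {ys} (y∉ ∘ subst (_∈ map class ys) (class-sibling y j))) (readDigits-sibling y j)

      target : ∀ j → partial (y ∷ ys) (sibling y j) ≡ readDigits ps y ∷ʳ j
      target j = trans (partial-∈ {y ∷ ys} (here (class-sibling y j))) (readDigits-∷ʳ-sibling y j)

      frame : ∀ x → (∀ j → sibling y j ≢ x) → partial (y ∷ ys) x ≡ partial ys x
      frame x x≢sibling = partial-cong {y ∷ ys} {ys} (mk⇔ drop-y there)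
        where
        drop-y : class x ∈ map class (y ∷ ys) → class x ∈ map class ys
        drop-y (here eq)  = ⊥-elim (x≢sibling _ (sym (class≡⇒sibling eq)))
        drop-y (there x∈) = x∈

    partial-∷ : ∀ y ys → partial ys ⇝ partial (y ∷ ys)
    partial-∷ y ys with class y ∈? map class ys
    ... | yes y∈ = ≗⇒⇝ λ x → partial-cong {ys} {y ∷ ys} (mk⇔ there (drop-y x))
      where
      drop-y : ∀ x → class x ∈ map class (y ∷ ys) → class x ∈ map class ys
      drop-y x (here eq)  = subst (_∈ map class ys) (sym eq) y∈
      drop-y x (there x∈) = x∈
    ... | no  y∉ = Fire⇒⇝ (fire-class y ys y∉)

    partial-reachable : ∀ ys → readDigits ps ⇝ partial ys
    partial-reachable []       = ≗⇒⇝ λ _ → refl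
    partial-reachable (y ∷ ys) = ⇝-trans (partial-reachable ys) (partial-∷ y ys)

    extend : readDigits ps ⇝ readDigits (ps ∷ʳ p)
    extend = ⇝-trans (partial-reachable (allFin _)) (≗⇒⇝ λ x → partial-∈ (∈-map⁺ class (∈-allFin x)))

  readDigits-reachable : ∀ ps qs → Unique (ps ++ qs) → readDigits ps ⇝ readDigits (ps ++ qs)
  readDigits-reachable ps []       _      = ≗⇒⇝ λ x → cong (map _) (sym (++-identityʳ ps))
  readDigits-reachable ps (q ∷ qs) unique = ⇝-trans (Extend.extend ps q (Unique-++-∷⇒∉ ps unique))
    (subst (λ qs′ → readDigits (ps ∷ʳ q) ⇝ readDigits qs′) (++-assoc ps (q ∷ []) qs)
           (readDigits-reachable (ps ∷ʳ q) qs (subst Unique (sym (++-assoc ps (q ∷ []) qs)) unique)))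

tabulate-injective : ∀ {a} {A : Set a} {n} {f g : Fin n → A} → tabulate f ≡ tabulate g → f ≗ g
tabulate-injective {n = suc n} eq Fin.zero    = proj₁ (∷-injective eq)
tabulate-injective {n = suc n} eq (Fin.suc i) = tabulate-injective (proj₂ (∷-injective eq)) i

map-allFin-injective : ∀ {a} {A : Set a} {n} {f g : Fin n → A} → map f (allFin n) ≡ map g (allFin n) → f ≗ g
map-allFin-injective {n = n} {f} {g} eq =
  tabulate-injective (trans (sym (map-tabulate {n = n} (λ i → i) f)) (trans eq (map-tabulate (λ i → i) g)))

module _ {k M : ℕ} (c : Config k M) (c-injective : ∀ {x y} → c x ≡ c y → x ≡ y) where

  chipsAt≤1 : ∀ v → chipsAt c v ≤ 1
  chipsAt≤1 v = at-most-one _ (Unique.filter⁺ (λ x → c x ≟ᵥ v) (Unique.allFin⁺ M))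
                              (all-filter (λ x → c x ≟ᵥ v) (allFin M))
    where
    at-most-one : ∀ xs → Unique xs → All (λ x → c x ≡ v) xs → length xs ≤ 1
    at-most-one []          _                   _                  = z≤n
    at-most-one (_ ∷ [])    _                   _                  = s≤s z≤n
    at-most-one (_ ∷ _ ∷ _) ((x≢y ∷ _) ∷ _) (cx≡v ∷ cy≡v ∷ _) = ⊥-elim (x≢y (c-injective (trans cx≡v (sym cy≡v))))

  injective⇒stable : 2 ≤ k → Stable c
  injective⇒stable 2≤k v = ≤-trans (s≤s (chipsAt≤1 v)) 2≤k

module _ (k : ℕ) .{{_ : NonZero k}} where

  Fw-config-injective : ∀ N (π : Permutation′ N) {x y} → Fw-config k N π x ≡ Fw-config k N π y → x ≡ y
  Fw-config-injective N π {x} {y} eq = toℕ-injective (digits-injective k N (toℕ<n x) (toℕ<n y)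
    (tabulate-cong λ j → subst (λ i → digit k N (suc (toℕ i)) (toℕ x) ≡ digit k N (suc (toℕ i)) (toℕ y))
                                   (inverseʳ π) (map-allFin-injective eq (π ⟨$⟩ˡ j))))

  Fw-config≗readDigits : ∀ N (π : Permutation′ N) →
                         Fw-config k N π ≗ ReadDigits.readDigits k N (map (π ⟨$⟩ʳ_) (allFin N))
  Fw-config≗readDigits N π x = sym (trans (sym (map-∘ (allFin N)))
    (map-cong (λ i → lookup∘tabulate _ (π ⟨$⟩ʳ i)) (allFin N)))

  initial⇝Fw-config : ∀ N (π : Permutation′ N) → initial ⇝ Fw-config k N π
  initial⇝Fw-config N π = ⇝-trans
    (readDigits-reachable [] _ (Unique.map⁺ (Injection.injective (Inverse⇒Injection π)) (Unique.allFin⁺ N)))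
    (≗⇒⇝ λ x → sym (Fw-config≗readDigits N π x))
    where open ReadDigits k N

  Fw-config-reachable : ∀ N (π : Permutation′ N) → Star Fire initial (Fw-config k N π)
  Fw-config-reachable zero    π = ε
  Fw-config-reachable (suc N) π with ⇝⇒≗⊎Star (initial⇝Fw-config (suc N) π)
  ... | inj₂ fires      = fires
  ... | inj₁ initial≗Fw with initial≗Fw (fromℕ< (m^n>0 k (suc N)))
  ...   | ()

  I-lift₀ : ∀ n (w : Permutation′ n) → I k (suc n) (lift₀ w) ≡ k * I k n w
  I-lift₀ n w = begin
    inversions {M = k ^ suc n} (f ∘ toℕ) (suc n)  ≡⟨ inversions≡countInversions (k ^ suc n) f (suc n) ⟩
    countInversions (k * k ^ n) f (suc n)         ≡⟨ countInversions-block (k ^ n) f g f-block n ⟩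
    k * countInversions (k ^ n) g n               ≡⟨ cong (k *_) (inversions≡countInversions (k ^ n) g n) ⟨
    k * inversions {M = k ^ n} (g ∘ toℕ) n         ∎
    where
    open ≡-Reasoning
    f g : ℕ → Vertex k
    f a = map (λ i → digit k (suc n) (suc (toℕ (lift₀ w ⟨$⟩ʳ i))) a) (allFin (suc n))
    g a = map (λ i → digit k n (suc (toℕ (w ⟨$⟩ʳ i))) a) (allFin n)

    f≡leading∷g : ∀ a → f a ≡ digit k (suc n) 1 a ∷ g a
    f≡leading∷g a = cong (_ ∷_) (trans (map-tabulate {n = n} Fin.suc _) (sym (map-tabulate {n = n} (λ i → i) _)))

    f-block : ∀ {r q} (r<k : r < k) → q < k ^ n → f (r * k ^ n + q) ≡ fromℕ< r<k ∷ g q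
    f-block {r} {q} r<k q<k^n = trans (f≡leading∷g (r * k ^ n + q)) (cong₂ _∷_
      (toℕ-injective (trans (toℕ-leadingDigit k n r q<k^n) (trans (m<n⇒m%n≡m r<k) (sym (toℕ-fromℕ< r<k)))))
      (map-cong (λ i → digit-+-multiple k n r q (toℕ<n (w ⟨$⟩ʳ i))) (allFin n)))

proposition4p10 : (k : ℕ) → .{{_ : NonZero k}} → 2 ≤ k → (n A : ℕ) →
    (∃ λ (w : Permutation′ n) → A ≡ I k n w) →
    Σ (Config k (k ^ suc n)) λ c →
      Star Fire initial c × Stable c × inversions c (suc n) ≡ k * A
proposition4p10 k 2≤k n A (w , refl) =
  Fw-config k (suc n) (lift₀ w) ,
  Fw-config-reachable k (suc n) (lift₀ w) ,
  injective⇒stable _ (Fw-config-injective k (suc n) (lift₀ w)) 2≤k ,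
  I-lift₀ k n w
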